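{- Let $t\ge 3$ be an integer and let $G$ be a bipartite graph with bipartition $\{X,Y\}$ such that $K_t$ is not a 1-shallow minor of $G$. Then there is a 1-shallow minor $H$ of $G$ on $|X|$ vertices such that \[|\{N_G(u):u\in Y\}|\le\begin{cases}C(H,\le t-2)&\text{if }t\ge4,\\ C(H,\le 2)&\text{if }t=3.\end{cases}\]
   Context: A graph $H$ is an $r$-shallow minor of $G$ if there are pairwise vertex-disjoint subtrees $(T_v)_{v\in V(H)}$ of $G$, each of radius at most $r$, such that for each edge $vw\in E(H)$ there is an edge of $G$ between $T_v$ and $T_w$. For a graph $H$ and $k\in\mathbb{N}_0$, $C(H,\le k)$ is the number of cliques of $H$ with at most $k$ vertices, where the empty set counts as the unique clique of order $0$. $N_G(u)$ is the set of neighbours of $u$ in $G$. -}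

module Defs where

open import Data.Nat using (ℕ; zero; suc; _≤ᵇ_)
open import Data.Bool using (Bool; true; false; not; _∧_; _∨_)
open import Data.Fin using (Fin; _≟_)
open import Data.Fin.Subset using (Subset; ∣_∣)
open import Data.Vec using (Vec; []; _∷_; lookup; tabulate)
import Data.Vec.Properties as VecP
import Data.Bool.Properties as BoolP
open import Data.List using (List; []; _∷_; _++_; map; filter; filterᵇ; length; allFin; deduplicate; concatMap)
open import Data.Bool.ListAction using (and)
open import Data.Product using (Σ; ∃; _×_; _,_)
open import Data.Sum using (_⊎_)
open import Relation.Nullary using (¬_)
open import Relation.Nullary.Decidable using (⌊_⌋)
open import Relation.Binary.PropositionalEquality using (_≡_; _≢_)

record Graph (n : ℕ) : Set where
  field
    adj    : Fin n → Fin n → Bool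
    sym    : ∀ i j → adj i j ≡ adj j i
    irrefl : ∀ i → adj i i ≡ false
open Graph public

-- Bipartition {X, Y} of V(G): X is a subset, Y its complement, and every
-- edge has exactly one end in X.
IsBipartition : ∀ {n} → Graph n → Subset n → Set
IsBipartition G X = ∀ i j → adj G i j ≡ true → lookup X i ≢ lookup X j

InY : ∀ {n} → Subset n → Fin n → Bool
InY X u = not (lookup X u)

private
  neq : ∀ {t} → Fin t → Fin t → Bool
  neq i j = not ⌊ i ≟ j ⌋

  neq-sym : ∀ {t} (i j : Fin t) → neq i j ≡ neq j i
  neq-sym i j with i ≟ j | j ≟ i
  ... | Relation.Nullary.yes _ | Relation.Nullary.yes _ = Relation.Binary.PropositionalEquality.refl
  ... | Relation.Nullary.no _  | Relation.Nullary.no _  = Relation.Binary.PropositionalEquality.refl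
  ... | Relation.Nullary.yes p | Relation.Nullary.no q  = Data.Empty.⊥-elim (q (Relation.Binary.PropositionalEquality.sym p))
    where import Data.Empty
  ... | Relation.Nullary.no q  | Relation.Nullary.yes p = Data.Empty.⊥-elim (q (Relation.Binary.PropositionalEquality.sym p))
    where import Data.Empty

  neq-irr : ∀ {t} (i : Fin t) → neq i i ≡ false
  neq-irr i with i ≟ i
  ... | Relation.Nullary.yes _ = Relation.Binary.PropositionalEquality.refl
  ... | Relation.Nullary.no q  = Data.Empty.⊥-elim (q Relation.Binary.PropositionalEquality.refl)
    where import Data.Empty

K : (t : ℕ) → Graph t
K t = record { adj = neq ; sym = neq-sym ; irrefl = neq-irr }

-- H is a 1-shallow minor of G: pairwise vertex-disjoint subtrees (T_v) of G
-- of radius ≤ 1, with an edge of G between T_v and T_w for each edge vw of H.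
-- A subtree of radius ≤ 1 is a star: a centre c_v together with some
-- neighbours of c_v; we record its vertex set (branch v) and its centre.
record OneShallowModel {m n : ℕ} (H : Graph m) (G : Graph n) : Set where
  field
    centre    : Fin m → Fin n
    branch    : Fin m → Fin n → Bool
    centre∈   : ∀ v → branch v (centre v) ≡ true
    star      : ∀ v x → branch v x ≡ true → x ≡ centre v ⊎ adj G (centre v) x ≡ true
    disjoint  : ∀ v w x → branch v x ≡ true → branch w x ≡ true → v ≡ w
    edges     : ∀ v w → adj H v w ≡ true →
                Σ (Fin n) λ x → Σ (Fin n) λ y →
                  branch v x ≡ true × branch w y ≡ true × adj G x y ≡ true

IsOneShallowMinor : ∀ {m n} → Graph m → Graph n → Set
IsOneShallowMinor H G = OneShallowModel H G

allSubsets : (m : ℕ) → List (Subset m)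
allSubsets zero    = [] ∷ []
allSubsets (suc m) = map (true ∷_) (allSubsets m) ++ map (false ∷_) (allSubsets m)

isCliqueᵇ : ∀ {m} → Graph m → Subset m → Bool
isCliqueᵇ {m} H S =
  and (concatMap (λ i → map (λ j →
         not (lookup S i ∧ lookup S j ∧ not ⌊ i ≟ j ⌋) ∨ adj H i j)
       (allFin m)) (allFin m))

-- C(H, ≤ k): number of cliques of H with at most k vertices (∅ included).
C≤ : ∀ {m} → Graph m → ℕ → ℕ
C≤ {m} H k = length (filterᵇ (λ S → isCliqueᵇ H S ∧ (∣ S ∣ ≤ᵇ k)) (allSubsets m))

N : ∀ {n} → Graph n → Fin n → Subset n
N G u = tabulate (adj G u)

numNbhds : ∀ {n} → Graph n → Subset n → ℕ
numNbhds {n} G X =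
  length (deduplicate (VecP.≡-dec BoolP._≟_)
           (map (N G) (filterᵇ (InY X) (allFin n))))

{-# OPTIONS --safe #-}
-- Process the vertices of Y one at a time, those of degree two first. If the neighbourhood of v
-- is not yet a clique of the current graph on X, pick non-adjacent neighbours x, y and contract v
-- into the star of x; this creates the edge xy, and the stars stay disjoint trees of radius one,
-- so the final graph H is a 1-shallow minor of G. Every vertex v of Y that is not contracted ends
-- up with a neighbourhood that is a clique of H, of size at most t − 2 since otherwise v and the
-- stars of t − 1 of its neighbours would model K_t. Send a neighbourhood to itself if it is such a clique, and otherwise
-- to the edge xy created by contracting a vertex with that neighbourhood; so cliques of size at
-- most max(2, t − 2) suffice. Handling degree two first makes this map injective: a neighbourhood
-- equal to an edge xy has degree two, so xy already existed after the first phase and was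
-- created by a vertex with neighbourhood {x, y}.
module Submission where

open import Defs hiding (sym)
open import Data.Nat using (ℕ; zero; suc; _≤_; _<_; _+_; _∸_; z≤n; s≤s; _≤ᵇ_)
import Data.Nat as ℕ
import Data.Nat.Properties as ℕ
open import Data.Bool using (Bool; true; false; not; _∧_; _∨_; T; T?)
import Data.Bool.Properties as Bool
open import Data.Fin using (Fin; zero; suc; _≟_)
import Data.Fin.Properties as Fin
open import Data.Fin.Subset using (Subset; ∣_∣; ⁅_⁆; _∪_; _⊆_; _∈_)
open import Data.Fin.Subset.Properties
  using (x∈p∪q⁺; x∈p∪q⁻; p⊆p∪q; x∈⁅x⁆; x∈⁅y⁆⇒x≡y; x≢y⇒x∉⁅y⁆; ∣⁅x⁆∣≡1; _∈?_;
         ⊆-antisym; drop-∷-⊆; p⊂q⇒∣p∣<∣q∣)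
open import Data.Vec using ([]; _∷_; lookup)
import Data.Vec as Vec
import Data.Vec.Properties as Vec
open import Data.List using (List; []; _∷_; map; length; filter; filterᵇ; allFin; deduplicate; foldl)
open import Data.Bool.ListAction using (and)
open import Data.List.Relation.Unary.Any using (Any; here; there; any?)
open import Data.List.Relation.Unary.All as All using (All; []; _∷_)
open import Data.List.Relation.Unary.All.Properties using (concat⁺; map⁺; ¬Any⇒All¬)
import Data.List.Relation.Unary.Any as Any
open import Data.List.Relation.Unary.AllPairs using (AllPairs; []; _∷_)
open import Data.List.Relation.Unary.Unique.Propositional using (Unique)
import Data.List.Relation.Unary.Unique.DecPropositional.Properties as Unique
open import Data.List.Membership.Propositional using (find; lose) renaming (_∈_ to _∈ₗ_)
open import Data.List.Relation.Binary.Subset.Propositional using () renaming (_⊆_ to _⊆ₗ_)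
open import Data.List.Relation.Binary.Subset.Propositional.Properties using (Any-resp-⊆)
open import Data.List.Membership.Propositional.Properties
  using (∈-++⁺ˡ; ∈-++⁺ʳ; ∈-map⁺; ∈-map⁻; ∈-filter⁺; ∈-filter⁻; ∈-deduplicate⁻)
open import Data.Product using (Σ; ∃; _×_; _,_; proj₁; proj₂)
open import Data.Sum using (_⊎_; inj₁; inj₂; swap)
open import Data.Empty using (⊥; ⊥-elim)
open import Function using (_∘_; id; _⇔_; mk⇔)
open import Function.Definitions using (Injective)
open import Relation.Nullary using (¬_; Dec; yes; no; does; ¬?)
open import Relation.Nullary.Decidable
  using (⌊_⌋; decidable-stable; dec-true; dec-false; does-⇔; _×-dec_; _⊎-dec_; _→-dec_)
open import Relation.Binary.PropositionalEquality

from-does : ∀ {A : Set} (a? : Dec A) → does a? ≡ true → A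
from-does (yes a) _ = a

module _ {A B : Set} where

  private
    remove : ∀ {y} (ys : List B) → y ∈ₗ ys → List B
    remove (_ ∷ ys) (here _)  = ys
    remove (z ∷ ys) (there p) = z ∷ remove ys p

    length-remove : ∀ {y} (ys : List B) (p : y ∈ₗ ys) → suc (length (remove ys p)) ≡ length ys
    length-remove (_ ∷ ys) (here _)  = refl
    length-remove (_ ∷ ys) (there p) = cong suc (length-remove ys p)

    ∈-remove : ∀ {y z} (ys : List B) (p : y ∈ₗ ys) → z ∈ₗ ys → z ≢ y → z ∈ₗ remove ys p
    ∈-remove (_ ∷ ys) (here refl) (here refl) z≢y = ⊥-elim (z≢y refl)
    ∈-remove (_ ∷ ys) (here refl) (there q)   z≢y = q
    ∈-remove (_ ∷ ys) (there p)   (here refl) z≢y = here refl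
    ∈-remove (_ ∷ ys) (there p)   (there q)   z≢y = there (∈-remove ys p q z≢y)

  length-≤-injection : ∀ {xs : List A} {ys : List B} (f : A → B) → Unique xs →
    (∀ {a b} → a ∈ₗ xs → b ∈ₗ xs → f a ≡ f b → a ≡ b) →
    (∀ {a} → a ∈ₗ xs → f a ∈ₗ ys) → length xs ≤ length ys
  length-≤-injection {[]}     f _ _ _ = z≤n
  length-≤-injection {a ∷ xs} {ys} f (a∉xs ∷ unique) inj into =
    subst (suc (length xs) ≤_) (length-remove ys fa∈ys)
      (s≤s (length-≤-injection f unique (λ p q → inj (there p) (there q)) into′))
    where
    fa∈ys = into (here refl)
    into′ : ∀ {b} → b ∈ₗ xs → f b ∈ₗ remove ys fa∈ys
    into′ b∈xs = ∈-remove ys fa∈ys (into (there b∈xs))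
      (λ fb≡fa → All.lookup a∉xs b∈xs (inj (here refl) (there b∈xs) (sym fb≡fa)))

AllPairs-≡ : ∀ {A : Set} {R : A → A → Set} {xs x y} → AllPairs R xs → x ∈ₗ xs → y ∈ₗ xs →
  ¬ R x y → ¬ R y x → x ≡ y
AllPairs-≡ (_   ∷ _)  (here refl) (here refl) _    _    = refl
AllPairs-≡ (Rx∷ ∷ _)  (here refl) (there y∈)  ¬Rxy _    = ⊥-elim (¬Rxy (All.lookup Rx∷ y∈))
AllPairs-≡ (Ry∷ ∷ _)  (there x∈)  (here refl) _    ¬Ryx = ⊥-elim (¬Ryx (All.lookup Ry∷ x∈))
AllPairs-≡ (_   ∷ ps) (there x∈)  (there y∈)  ¬Rxy ¬Ryx = AllPairs-≡ ps x∈ y∈ ¬Rxy ¬Ryx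

and-true : ∀ {bs} → All (_≡ true) bs → and bs ≡ true
and-true []          = refl
and-true (refl ∷ ps) = and-true ps

isCliqueᵇ-intro : ∀ {m} (H : Graph m) (S : Subset m) →
  (∀ {i j} → i ∈ S → j ∈ S → i ≢ j → adj H i j ≡ true) → isCliqueᵇ H S ≡ true
isCliqueᵇ-intro {m} H S clique =
  and-true (concat⁺ (map⁺ (All.universal (λ i → map⁺ (All.universal (entry i) (allFin m))) (allFin m))))
  where
  entry : ∀ i j → (not (lookup S i ∧ lookup S j ∧ not ⌊ i ≟ j ⌋) ∨ adj H i j) ≡ true
  entry i j with lookup S i in i∈S | lookup S j in j∈S | i ≟ j
  ... | false | _     | _       = refl
  ... | true  | false | _       = refl
  ... | true  | true  | yes _   = refl
  ... | true  | true  | no i≢j  = clique (Vec.lookup⇒[]= i S i∈S) (Vec.lookup⇒[]= j S j∈S) i≢j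

∈-allSubsets : ∀ {m} (S : Subset m) → S ∈ₗ allSubsets m
∈-allSubsets []          = here refl
∈-allSubsets (true ∷ S)  = ∈-++⁺ˡ (∈-map⁺ (true ∷_) (∈-allSubsets S))
∈-allSubsets (false ∷ S) = ∈-++⁺ʳ _ (∈-map⁺ (false ∷_) (∈-allSubsets S))

∈-smallCliques : ∀ {m} (H : Graph m) {k} {S : Subset m} → isCliqueᵇ H S ≡ true → ∣ S ∣ ≤ k →
  S ∈ₗ filterᵇ (λ S → isCliqueᵇ H S ∧ (∣ S ∣ ≤ᵇ k)) (allSubsets m)
∈-smallCliques H {k} {S} clique ∣S∣≤k = ∈-filter⁺ (λ S → T? (isCliqueᵇ H S ∧ (∣ S ∣ ≤ᵇ k)))
  (∈-allSubsets S) (subst (λ b → T (b ∧ (∣ S ∣ ≤ᵇ k))) (sym clique) (ℕ.≤⇒≤ᵇ ∣S∣≤k))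

-- Fin ∣ X ∣ numbers the elements of X in increasing order; restrict X S is S ∩ X in this numbering.
embed : ∀ {n} (X : Subset n) → Fin ∣ X ∣ → Fin n
embed (true ∷ X)  zero    = zero
embed (true ∷ X)  (suc i) = suc (embed X i)
embed (false ∷ X) i       = suc (embed X i)

embed-∈ : ∀ {n} (X : Subset n) i → lookup X (embed X i) ≡ true
embed-∈ (true ∷ X)  zero    = refl
embed-∈ (true ∷ X)  (suc i) = embed-∈ X i
embed-∈ (false ∷ X) i       = embed-∈ X i

embed-injective : ∀ {n} (X : Subset n) → Injective _≡_ _≡_ (embed X)
embed-injective (true ∷ X)  {zero}  {zero}  _  = refl
embed-injective (true ∷ X)  {suc i} {suc j} eq = cong suc (embed-injective X (Fin.suc-injective eq))
embed-injective (false ∷ X)                 eq = embed-injective X (Fin.suc-injective eq)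

restrict : ∀ {n} (X : Subset n) → Subset n → Subset ∣ X ∣
restrict []          []      = []
restrict (true ∷ X)  (s ∷ S) = s ∷ restrict X S
restrict (false ∷ X) (s ∷ S) = restrict X S

restrict-∈⁻ : ∀ {n} (X S : Subset n) {i} → i ∈ restrict X S → embed X i ∈ S
restrict-∈⁻ (true ∷ X)  (s ∷ S) {zero}  Vec.here       = Vec.here
restrict-∈⁻ (true ∷ X)  (s ∷ S) {suc i} (Vec.there i∈) = Vec.there (restrict-∈⁻ X S i∈)
restrict-∈⁻ (false ∷ X) (s ∷ S)         i∈             = Vec.there (restrict-∈⁻ X S i∈)

∣restrict∣ : ∀ {n} (X : Subset n) {S} → S ⊆ X → ∣ restrict X S ∣ ≡ ∣ S ∣
∣restrict∣ []          {[]}          _   = refl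
∣restrict∣ (true ∷ X)  {true ∷ S}    S⊆X = cong suc (∣restrict∣ X (drop-∷-⊆ S⊆X))
∣restrict∣ (true ∷ X)  {false ∷ S}   S⊆X = ∣restrict∣ X (drop-∷-⊆ S⊆X)
∣restrict∣ (false ∷ X) {true ∷ S}    S⊆X with () ← S⊆X Vec.here
∣restrict∣ (false ∷ X) {false ∷ S}   S⊆X = ∣restrict∣ X (drop-∷-⊆ S⊆X)

restrict-injective : ∀ {n} (X : Subset n) {S T} → S ⊆ X → T ⊆ X → restrict X S ≡ restrict X T → S ≡ T
restrict-injective []          {[]}        {[]}        _   _   _  = refl
restrict-injective (true ∷ X)  {s ∷ S}     {t ∷ T}     S⊆X T⊆X eq =
  cong₂ _∷_ (Vec.∷-injectiveˡ eq)
            (restrict-injective X (drop-∷-⊆ S⊆X) (drop-∷-⊆ T⊆X) (Vec.∷-injectiveʳ eq))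
restrict-injective (false ∷ X) {true ∷ S}  {_}         S⊆X T⊆X eq with () ← S⊆X Vec.here
restrict-injective (false ∷ X) {false ∷ S} {true ∷ T}  S⊆X T⊆X eq with () ← T⊆X Vec.here
restrict-injective (false ∷ X) {false ∷ S} {false ∷ T} S⊆X T⊆X eq =
  cong (false ∷_) (restrict-injective X (drop-∷-⊆ S⊆X) (drop-∷-⊆ T⊆X) eq)

∣p∪q∣≤∣p∣+∣q∣ : ∀ {n} (p q : Subset n) → ∣ p ∪ q ∣ ≤ ∣ p ∣ + ∣ q ∣
∣p∪q∣≤∣p∣+∣q∣ []          []          = z≤n
∣p∪q∣≤∣p∣+∣q∣ (true ∷ p)  (true ∷ q)  =
  s≤s (ℕ.≤-trans (ℕ.m≤n⇒m≤1+n (∣p∪q∣≤∣p∣+∣q∣ p q))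
                 (ℕ.≤-reflexive (sym (ℕ.+-suc ∣ p ∣ ∣ q ∣))))
∣p∪q∣≤∣p∣+∣q∣ (true ∷ p)  (false ∷ q) = s≤s (∣p∪q∣≤∣p∣+∣q∣ p q)
∣p∪q∣≤∣p∣+∣q∣ (false ∷ p) (true ∷ q)  =
  ℕ.≤-trans (s≤s (∣p∪q∣≤∣p∣+∣q∣ p q)) (ℕ.≤-reflexive (sym (ℕ.+-suc ∣ p ∣ ∣ q ∣)))
∣p∪q∣≤∣p∣+∣q∣ (false ∷ p) (false ∷ q) = ∣p∪q∣≤∣p∣+∣q∣ p q

pair : ∀ {n} → Fin n → Fin n → Subset n
pair x y = ⁅ x ⁆ ∪ ⁅ y ⁆

module _ {n} {x y : Fin n} where

  x∈pair : x ∈ pair x y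
  x∈pair = x∈p∪q⁺ (inj₁ (x∈⁅x⁆ x))

  y∈pair : y ∈ pair x y
  y∈pair = x∈p∪q⁺ (inj₂ (x∈⁅x⁆ y))

  ∈pair⁻ : ∀ {z} → z ∈ pair x y → z ≡ x ⊎ z ≡ y
  ∈pair⁻ z∈ with x∈p∪q⁻ ⁅ x ⁆ ⁅ y ⁆ z∈
  ... | inj₁ z∈⁅x⁆ = inj₁ (x∈⁅y⁆⇒x≡y x z∈⁅x⁆)
  ... | inj₂ z∈⁅y⁆ = inj₂ (x∈⁅y⁆⇒x≡y y z∈⁅y⁆)

  pair⊆ : ∀ {S} → x ∈ S → y ∈ S → pair x y ⊆ S
  pair⊆ x∈S y∈S z∈ with ∈pair⁻ z∈
  ... | inj₁ refl = x∈S
  ... | inj₂ refl = y∈S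

  ∣pair∣≤2 : ∣ pair x y ∣ ≤ 2
  ∣pair∣≤2 = ℕ.≤-trans (∣p∪q∣≤∣p∣+∣q∣ ⁅ x ⁆ ⁅ y ⁆)
                       (ℕ.≤-reflexive (cong₂ _+_ (∣⁅x⁆∣≡1 x) (∣⁅x⁆∣≡1 y)))

  ∣pair∣≡2 : x ≢ y → ∣ pair x y ∣ ≡ 2
  ∣pair∣≡2 x≢y = ℕ.≤-antisym ∣pair∣≤2 (subst (_< ∣ pair x y ∣) (∣⁅x⁆∣≡1 x)
    (p⊂q⇒∣p∣<∣q∣ (p⊆p∪q ⁅ y ⁆ , y , y∈pair , x≢y⇒x∉⁅y⁆ (x≢y ∘ sym))))

  ∣p∣≡2⇒p≡pair : ∀ {S} → ∣ S ∣ ≡ 2 → x ∈ S → y ∈ S → x ≢ y → S ≡ pair x y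
  ∣p∣≡2⇒p≡pair {S} ∣S∣≡2 x∈S y∈S x≢y = ⊆-antisym S⊆pair (pair⊆ x∈S y∈S)
    where
    S⊆pair : S ⊆ pair x y
    S⊆pair {z} z∈S = decidable-stable (z ∈? pair x y) λ z∉pair →
      ℕ.<-irrefl (trans (∣pair∣≡2 x≢y) (sym ∣S∣≡2))
                 (p⊂q⇒∣p∣<∣q∣ (pair⊆ x∈S y∈S , z , z∈S , z∉pair))

pair-injective : ∀ {n} {x y x′ y′ : Fin n} → x ≢ y → pair x y ≡ pair x′ y′ →
  (x′ ≡ x × y′ ≡ y) ⊎ (x′ ≡ y × y′ ≡ x)
pair-injective x≢y eq with ∈pair⁻ (subst (_ ∈_) eq x∈pair) | ∈pair⁻ (subst (_ ∈_) eq y∈pair)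
... | inj₁ refl | inj₁ refl = ⊥-elim (x≢y refl)
... | inj₁ refl | inj₂ refl = inj₁ (refl , refl)
... | inj₂ refl | inj₁ refl = inj₂ (refl , refl)
... | inj₂ refl | inj₂ refl = ⊥-elim (x≢y refl)

injection-into : ∀ {n} (S : Subset n) {k} → k ≤ ∣ S ∣ →
  Σ (Fin k → Fin n) λ f → (∀ i → f i ∈ S) × Injective _≡_ _≡_ f
injection-into S           {zero}  _ = (λ ()) , (λ ()) , (λ {i} → ⊥-elim (Fin.¬Fin0 i))
injection-into (true ∷ S)  {suc k} (s≤s k≤∣S∣) =
  let f , f∈S , f-inj = injection-into S k≤∣S∣ in g f , g∈ f∈S , g-inj f-inj
  where
  g : (Fin k → Fin _) → Fin (suc k) → Fin _
  g f zero    = zero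
  g f (suc i) = suc (f i)
  g∈ : ∀ {f} → (∀ i → f i ∈ S) → ∀ i → g f i ∈ true ∷ S
  g∈ f∈S zero    = Vec.here
  g∈ f∈S (suc i) = Vec.there (f∈S i)
  g-inj : ∀ {f} → Injective _≡_ _≡_ f → Injective _≡_ _≡_ (g f)
  g-inj f-inj {zero}  {zero}  _  = refl
  g-inj f-inj {suc i} {suc j} eq = cong suc (f-inj (Fin.suc-injective eq))
injection-into (false ∷ S) {suc k} k≤∣S∣ =
  let f , f∈S , f-inj = injection-into S k≤∣S∣ in
  suc ∘ f , Vec.there ∘ f∈S , f-inj ∘ Fin.suc-injective

module _ {n} (G : Graph n) {v a : Fin n} where

  ∈N⁻ : a ∈ N G v → adj G v a ≡ true
  ∈N⁻ a∈N = trans (sym (Vec.lookup∘tabulate (adj G v) a)) (Vec.[]=⇒lookup a∈N)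

  ∈N⁺ : adj G v a ≡ true → a ∈ N G v
  ∈N⁺ va = Vec.lookup⇒[]= a (N G v) (trans (Vec.lookup∘tabulate (adj G v) a) va)

  adj⇒≢ : adj G v a ≡ true → v ≢ a
  adj⇒≢ va refl with () ← trans (sym va) (irrefl G v)

module Greedy {n} (G : Graph n) (X : Subset n) (bipartite : IsBipartition G X) where

  nbr-∈X : ∀ {v a} → lookup X v ≡ false → adj G v a ≡ true → lookup X a ≡ true
  nbr-∈X {v} {a} v∉X va with lookup X a in a∈X
  ... | true  = refl
  ... | false = ⊥-elim (bipartite v a va (trans v∉X (sym a∈X)))

  N⊆X : ∀ {v} → lookup X v ≡ false → N G v ⊆ X
  N⊆X v∉X a∈N = Vec.lookup⇒[]= _ X (nbr-∈X v∉X (∈N⁻ G a∈N))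

  -- Contracting the apex into the star of leaf₁ creates the edge leaf₁ leaf₂ of the minor.
  record Cherry : Set where
    constructor cherry
    field
      apex leaf₁ leaf₂ : Fin n
      apex∉X           : lookup X apex ≡ false
      apex-leaf₁       : adj G apex leaf₁ ≡ true
      apex-leaf₂       : adj G apex leaf₂ ≡ true
      leaf₁≢leaf₂      : leaf₁ ≢ leaf₂
  open Cherry public

  Joins : Fin n → Fin n → Cherry → Set
  Joins a b c = (leaf₁ c ≡ a × leaf₂ c ≡ b) ⊎ (leaf₁ c ≡ b × leaf₂ c ≡ a)

  joins? : ∀ a b c → Dec (Joins a b c)
  joins? a b c = ((leaf₁ c ≟ a) ×-dec (leaf₂ c ≟ b)) ⊎-dec ((leaf₁ c ≟ b) ×-dec (leaf₂ c ≟ a))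

  Joins-flip : ∀ {c c′} → Joins (leaf₁ c) (leaf₂ c) c′ → Joins (leaf₁ c′) (leaf₂ c′) c
  Joins-flip (inj₁ (p , q)) = inj₁ (sym p , sym q)
  Joins-flip (inj₂ (p , q)) = inj₂ (sym q , sym p)

  ¬Joins-loop : ∀ {a} c → ¬ Joins a a c
  ¬Joins-loop c (inj₁ (p , q)) = leaf₁≢leaf₂ c (trans p (sym q))
  ¬Joins-loop c (inj₂ (p , q)) = leaf₁≢leaf₂ c (trans p (sym q))

  Adjacent : List Cherry → Fin n → Fin n → Set
  Adjacent cs a b = Any (Joins a b) cs

  adjacent? : ∀ cs a b → Dec (Adjacent cs a b)
  adjacent? cs a b = any? (joins? a b) cs

  Adjacent-irrefl : ∀ {cs a} → ¬ Adjacent cs a a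
  Adjacent-irrefl (here {x = c} loop) = ¬Joins-loop c loop
  Adjacent-irrefl (there rest)        = Adjacent-irrefl rest

  Adjacent-sym : ∀ {cs a b} → Adjacent cs a b ⇔ Adjacent cs b a
  Adjacent-sym = mk⇔ (Any.map swap) (Any.map swap)

  minorOf : List Cherry → Graph ∣ X ∣
  minorOf cs = record
    { adj    = λ i j → does (adjacent? cs (embed X i) (embed X j))
    ; sym    = λ i j → does-⇔ Adjacent-sym (adjacent? cs _ _) (adjacent? cs _ _)
    ; irrefl = λ i → dec-false (adjacent? cs _ _) Adjacent-irrefl
    }

  Branch : List Cherry → Fin n → Fin n → Set
  Branch cs a z = z ≡ a ⊎ Any (λ c → apex c ≡ z × leaf₁ c ≡ a) cs

  branch? : ∀ cs a z → Dec (Branch cs a z)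
  branch? cs a z = (z ≟ a) ⊎-dec any? (λ c → (apex c ≟ z) ×-dec (leaf₁ c ≟ a)) cs

  IsCliqueIn : List Cherry → Subset n → Set
  IsCliqueIn cs S = ∀ a b → a ∈ S → b ∈ S → a ≢ b → Adjacent cs a b

  isCliqueIn? : ∀ cs S → Dec (IsCliqueIn cs S)
  isCliqueIn? cs S = Fin.all? λ a → Fin.all? λ b →
    (a ∈? S) →-dec (b ∈? S) →-dec ¬? (a ≟ b) →-dec adjacent? cs a b

  MissingEdge : List Cherry → Fin n → Fin n → Fin n → Set
  MissingEdge cs v a b = adj G v a ≡ true × adj G v b ≡ true × a ≢ b × ¬ Adjacent cs a b

  missingEdge? : ∀ cs v a b → Dec (MissingEdge cs v a b)
  missingEdge? cs v a b =
    (adj G v a Bool.≟ true) ×-dec (adj G v b Bool.≟ true) ×-dec ¬? (a ≟ b) ×-dec ¬? (adjacent? cs a b)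

  data Step (cs : List Cherry) (v : Fin n) : Set where
    skip-X      : lookup X v ≡ true → Step cs v
    skip-apex   : Any (λ c → apex c ≡ v) cs → Step cs v
    skip-clique : IsCliqueIn cs (N G v) → Step cs v
    contract    : (c : Cherry) → apex c ≡ v → ¬ Adjacent cs (leaf₁ c) (leaf₂ c) →
                  All (λ c′ → apex c′ ≢ v) cs → Step cs v

  step? : ∀ cs v → Step cs v
  step? cs v with lookup X v in side
  ... | true = skip-X side
  ... | false with any? (λ c → apex c ≟ v) cs
  ...   | yes covered = skip-apex covered
  ...   | no ¬covered with Fin.any? (λ a → Fin.any? (missingEdge? cs v a))
  ...     | yes (a , b , va , vb , a≢b , ¬ab) =
              contract (cherry v a b side va vb a≢b) refl ¬ab (¬Any⇒All¬ cs ¬covered)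
  ...     | no none = skip-clique λ a b a∈N b∈N a≢b → decidable-stable (adjacent? cs a b)
              λ ¬ab → none (a , b , ∈N⁻ G a∈N , ∈N⁻ G b∈N , a≢b , ¬ab)

  extend : ∀ {cs v} → Step cs v → List Cherry
  extend {cs} (skip-X _)         = cs
  extend {cs} (skip-apex _)      = cs
  extend {cs} (skip-clique _)    = cs
  extend {cs} (contract c _ _ _) = c ∷ cs

  step : List Cherry → Fin n → List Cherry
  step cs v = extend (step? cs v)

  greedy : List Cherry → List (Fin n) → List Cherry
  greedy = foldl step

  extend-⊇ : ∀ {cs v} (s : Step cs v) → cs ⊆ₗ extend s
  extend-⊇ (skip-X _)         = id
  extend-⊇ (skip-apex _)      = id
  extend-⊇ (skip-clique _)    = id
  extend-⊇ (contract _ _ _ _) = there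

  greedy-⊇ : ∀ cs us → cs ⊆ₗ greedy cs us
  greedy-⊇ cs []       = id
  greedy-⊇ cs (v ∷ us) = greedy-⊇ (step cs v) us ∘ extend-⊇ (step? cs v)

  IsCliqueIn-mono : ∀ {cs cs′ S} → cs ⊆ₗ cs′ → IsCliqueIn cs S → IsCliqueIn cs′ S
  IsCliqueIn-mono cs⊆cs′ clique a b a∈S b∈S a≢b = Any-resp-⊆ cs⊆cs′ (clique a b a∈S b∈S a≢b)

  Apart : Cherry → Cherry → Set
  Apart c c′ = apex c ≢ apex c′ × ¬ Joins (leaf₁ c) (leaf₂ c) c′

  Sound : List Cherry → Set
  Sound = AllPairs Apart

  extend-sound : ∀ {cs v} (s : Step cs v) → Sound cs → Sound (extend s)
  extend-sound (skip-X _)                   sound = sound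
  extend-sound (skip-apex _)                sound = sound
  extend-sound (skip-clique _)              sound = sound
  extend-sound (contract c refl ¬adj fresh) sound =
    All.tabulate (λ c′∈ → (λ eq → All.lookup fresh c′∈ (sym eq)) , ¬adj ∘ lose c′∈) ∷ sound

  greedy-sound : ∀ cs us → Sound cs → Sound (greedy cs us)
  greedy-sound cs []       sound = sound
  greedy-sound cs (v ∷ us) sound = greedy-sound (step cs v) us (extend-sound (step? cs v) sound)

  module _ {cs} (sound : Sound cs) {c c′} (c∈ : c ∈ₗ cs) (c′∈ : c′ ∈ₗ cs) where

    apex-injective : apex c ≡ apex c′ → c ≡ c′
    apex-injective eq =
      AllPairs-≡ sound c∈ c′∈ (λ apart → proj₁ apart eq) (λ apart → proj₁ apart (sym eq))

    edge-injective : Joins (leaf₁ c) (leaf₂ c) c′ → c ≡ c′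
    edge-injective joins =
      AllPairs-≡ sound c∈ c′∈ (λ apart → proj₂ apart joins) (λ apart → proj₂ apart (Joins-flip {c} {c′} joins))

  Settled : List Cherry → Fin n → Set
  Settled cs v = lookup X v ≡ true ⊎ Any (λ c → apex c ≡ v) cs ⊎ IsCliqueIn cs (N G v)

  Settled-mono : ∀ {cs cs′ v} → cs ⊆ₗ cs′ → Settled cs v → Settled cs′ v
  Settled-mono cs⊆cs′ (inj₁ v∈X)            = inj₁ v∈X
  Settled-mono cs⊆cs′ (inj₂ (inj₁ covered)) = inj₂ (inj₁ (Any-resp-⊆ cs⊆cs′ covered))
  Settled-mono cs⊆cs′ (inj₂ (inj₂ clique))  = inj₂ (inj₂ (IsCliqueIn-mono cs⊆cs′ clique))

  extend-settles : ∀ {cs v} (s : Step cs v) → Settled (extend s) v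
  extend-settles (skip-X v∈X)         = inj₁ v∈X
  extend-settles (skip-apex covered)  = inj₂ (inj₁ covered)
  extend-settles (skip-clique clique) = inj₂ (inj₂ clique)
  extend-settles (contract c eq _ _)  = inj₂ (inj₁ (here eq))

  greedy-settles : ∀ cs {us v} → v ∈ₗ us → Settled (greedy cs us) v
  greedy-settles cs {v ∷ us} (here refl) =
    Settled-mono (greedy-⊇ (step cs v) us) (extend-settles (step? cs v))
  greedy-settles cs {w ∷ us} (there v∈)  = greedy-settles (step cs w) v∈

  extend-origin : ∀ {cs v c} (s : Step cs v) → c ∈ₗ extend s →
    c ∈ₗ cs ⊎ (apex c ≡ v × ¬ Adjacent cs (leaf₁ c) (leaf₂ c))
  extend-origin (skip-X _)               c∈          = inj₁ c∈
  extend-origin (skip-apex _)            c∈          = inj₁ c∈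
  extend-origin (skip-clique _)          c∈          = inj₁ c∈
  extend-origin (contract _ eq ¬adj _)   (here refl) = inj₂ (eq , ¬adj)
  extend-origin (contract _ _  _    _)   (there c∈)  = inj₁ c∈

  greedy-origin : ∀ cs us {c} → c ∈ₗ greedy cs us →
    c ∈ₗ cs ⊎ (apex c ∈ₗ us × ¬ Adjacent cs (leaf₁ c) (leaf₂ c))
  greedy-origin cs []       c∈ = inj₁ c∈
  greedy-origin cs (v ∷ us) c∈ with greedy-origin (step cs v) us c∈
  ... | inj₂ (apex∈ , ¬adj) = inj₂ (there apex∈ , ¬adj ∘ Any-resp-⊆ (extend-⊇ (step? cs v)))
  ... | inj₁ c∈′ with extend-origin (step? cs v) c∈′
  ...   | inj₁ c∈cs          = inj₁ c∈cs
  ...   | inj₂ (refl , ¬adj) = inj₂ (here refl , ¬adj)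

  covered⇒∉X : ∀ {cs z} {P : Cherry → Set} → Any (λ c → apex c ≡ z × P c) cs → lookup X z ≡ false
  covered⇒∉X covered with c , _ , refl , _ ← find covered = apex∉X c

  Branch-star : ∀ {cs a z} → Branch cs a z → z ≡ a ⊎ adj G a z ≡ true
  Branch-star (inj₁ z≡a)    = inj₁ z≡a
  Branch-star (inj₂ spoke) with c , _ , refl , refl ← find spoke =
    inj₂ (trans (Graph.sym G (leaf₁ c) (apex c)) (apex-leaf₁ c))

  Adjacent⇒edge : ∀ {cs a b} → Adjacent cs a b →
    Σ (Fin n) λ z → Σ (Fin n) λ w → Branch cs a z × Branch cs b w × adj G z w ≡ true
  Adjacent⇒edge adjacent with find adjacent
  ... | c , c∈ , inj₁ (refl , refl) =
    apex c , leaf₂ c , inj₂ (lose c∈ (refl , refl)) , inj₁ refl , apex-leaf₂ c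
  ... | c , c∈ , inj₂ (refl , refl) =
    leaf₂ c , apex c , inj₁ refl , inj₂ (lose c∈ (refl , refl)) ,
    trans (Graph.sym G (leaf₂ c) (apex c)) (apex-leaf₂ c)

  Branch-disjoint : ∀ {cs a b z} → Sound cs → lookup X a ≡ true → lookup X b ≡ true →
    Branch cs a z → Branch cs b z → a ≡ b
  Branch-disjoint sound a∈X b∈X (inj₁ z≡a) (inj₁ z≡b) = trans (sym z≡a) z≡b
  Branch-disjoint sound a∈X b∈X (inj₁ refl) (inj₂ covered)
    with () ← trans (sym a∈X) (covered⇒∉X covered)
  Branch-disjoint sound a∈X b∈X (inj₂ covered) (inj₁ refl)
    with () ← trans (sym b∈X) (covered⇒∉X covered)
  Branch-disjoint sound a∈X b∈X (inj₂ p) (inj₂ q)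
    with c , c∈ , apex≡z , refl ← find p | c′ , c′∈ , apex′≡z , refl ← find q
    with refl ← apex-injective sound c∈ c′∈ (trans apex≡z (sym apex′≡z)) = refl

  minorOf-model : ∀ {cs} → Sound cs → OneShallowModel (minorOf cs) G
  minorOf-model {cs} sound = record
    { centre   = embed X
    ; branch   = λ i z → does (branch? cs (embed X i) z)
    ; centre∈  = λ i → dec-true (branch? cs _ _) (inj₁ refl)
    ; star     = λ i z z∈ → Branch-star (from-does (branch? cs _ _) z∈)
    ; disjoint = λ i j z z∈i z∈j → embed-injective X
        (Branch-disjoint sound (embed-∈ X i) (embed-∈ X j)
                         (from-does (branch? cs _ _) z∈i) (from-does (branch? cs _ _) z∈j))
    ; edges    = λ i j ij → edge (from-does (adjacent? cs _ _) ij)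
    }
    where
    edge : ∀ {i j} → Adjacent cs (embed X i) (embed X j) → Σ (Fin n) λ z → Σ (Fin n) λ w →
      does (branch? cs (embed X i) z) ≡ true × does (branch? cs (embed X j) w) ≡ true × adj G z w ≡ true
    edge ij with z , w , z∈ , w∈ , zw ← Adjacent⇒edge ij =
      z , w , dec-true (branch? cs _ _) z∈ , dec-true (branch? cs _ _) w∈ , zw

  module _ {cs v} (sound : Sound cs) (v∉X : lookup X v ≡ false) (fresh : All (λ c → apex c ≢ v) cs)
           (clique : IsCliqueIn cs (N G v)) where

    ∉Branch : ∀ {a} → lookup X a ≡ true → ¬ Branch cs a v
    ∉Branch a∈X (inj₁ refl) with () ← trans (sym a∈X) v∉X
    ∉Branch a∈X (inj₂ spoke) with c , c∈ , apex≡v , _ ← find spoke = All.lookup fresh c∈ apex≡v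

    module _ {k} (u : Fin k → Fin n) (u∈N : ∀ i → u i ∈ N G v) (u-injective : Injective _≡_ _≡_ u) where

      u∈X : ∀ i → lookup X (u i) ≡ true
      u∈X i = nbr-∈X v∉X (∈N⁻ G (u∈N i))

      cone-centre : Fin (suc k) → Fin n
      cone-centre zero    = v
      cone-centre (suc i) = u i

      cone-branch : Fin (suc k) → Fin n → Bool
      cone-branch zero    z = does (z ≟ v)
      cone-branch (suc i) z = does (branch? cs (u i) z)

      cone-disjoint : ∀ p q z → cone-branch p z ≡ true → cone-branch q z ≡ true → p ≡ q
      cone-disjoint zero    zero    z _    _    = refl
      cone-disjoint zero    (suc j) z z∈p z∈q with refl ← from-does (z ≟ v) z∈p =
        ⊥-elim (∉Branch (u∈X j) (from-does (branch? cs _ _) z∈q))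
      cone-disjoint (suc i) zero    z z∈p z∈q with refl ← from-does (z ≟ v) z∈q =
        ⊥-elim (∉Branch (u∈X i) (from-does (branch? cs _ _) z∈p))
      cone-disjoint (suc i) (suc j) z z∈p z∈q = cong suc (u-injective
        (Branch-disjoint sound (u∈X i) (u∈X j)
                         (from-does (branch? cs _ _) z∈p) (from-does (branch? cs _ _) z∈q)))

      cone-edges : ∀ p q → adj (K (suc k)) p q ≡ true → Σ (Fin n) λ z → Σ (Fin n) λ w →
        cone-branch p z ≡ true × cone-branch q w ≡ true × adj G z w ≡ true
      cone-edges zero    zero    pq = ⊥-elim (adj⇒≢ (K (suc k)) {zero} pq refl)
      cone-edges zero    (suc j) _  =
        v , u j , dec-true (v ≟ v) refl , dec-true (branch? cs _ _) (inj₁ refl) , ∈N⁻ G (u∈N j)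
      cone-edges (suc i) zero    _  =
        u i , v , dec-true (branch? cs _ _) (inj₁ refl) , dec-true (v ≟ v) refl ,
        trans (Graph.sym G (u i) v) (∈N⁻ G (u∈N i))
      cone-edges (suc i) (suc j) pq
        with z , w , z∈ , w∈ , zw ← Adjacent⇒edge (clique (u i) (u j) (u∈N i) (u∈N j)
                                                     (adj⇒≢ (K (suc k)) pq ∘ cong suc ∘ u-injective)) =
        z , w , dec-true (branch? cs _ _) z∈ , dec-true (branch? cs _ _) w∈ , zw

      cone-model : OneShallowModel (K (suc k)) G
      cone-model = record
        { centre   = cone-centre
        ; branch   = cone-branch
        ; centre∈  = λ { zero → dec-true (v ≟ v) refl ; (suc i) → dec-true (branch? cs _ _) (inj₁ refl) }
        ; star     = λ { zero    z z∈ → inj₁ (from-does (z ≟ v) z∈)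
                       ; (suc i) z z∈ → Branch-star (from-does (branch? cs _ _) z∈) }
        ; disjoint = cone-disjoint
        ; edges    = cone-edges
        }

    K-model : ∀ {k} → k ≤ ∣ N G v ∣ → OneShallowModel (K (suc k)) G
    K-model k≤deg with u , u∈N , u-injective ← injection-into (N G v) k≤deg = cone-model u u∈N u-injective

    degree-bound : ∀ {j} → ¬ OneShallowModel (K (3 + j)) G → ∣ N G v ∣ ≤ suc j
    degree-bound noK = ℕ.≮⇒≥ (noK ∘ K-model)

  pair-IsCliqueIn : ∀ {cs c} → c ∈ₗ cs → IsCliqueIn cs (pair (leaf₁ c) (leaf₂ c))
  pair-IsCliqueIn c∈ a b a∈ b∈ a≢b with ∈pair⁻ a∈ | ∈pair⁻ b∈
  ... | inj₁ refl | inj₁ refl = ⊥-elim (a≢b refl)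
  ... | inj₁ refl | inj₂ refl = lose c∈ (inj₁ (refl , refl))
  ... | inj₂ refl | inj₁ refl = lose c∈ (inj₂ (refl , refl))
  ... | inj₂ refl | inj₂ refl = ⊥-elim (a≢b refl)

  leaves⊆N : ∀ c → pair (leaf₁ c) (leaf₂ c) ⊆ N G (apex c)
  leaves⊆N c = pair⊆ (∈N⁺ G (apex-leaf₁ c)) (∈N⁺ G (apex-leaf₂ c))

  N-of-degree-2 : ∀ c → ∣ N G (apex c) ∣ ≡ 2 → N G (apex c) ≡ pair (leaf₁ c) (leaf₂ c)
  N-of-degree-2 c deg =
    ∣p∣≡2⇒p≡pair deg (∈N⁺ G (apex-leaf₁ c)) (∈N⁺ G (apex-leaf₂ c)) (leaf₁≢leaf₂ c)

  restrict-isClique : ∀ {cs S} → IsCliqueIn cs S → isCliqueᵇ (minorOf cs) (restrict X S) ≡ true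
  restrict-isClique {cs} {S} clique = isCliqueᵇ-intro (minorOf cs) (restrict X S) λ i∈ j∈ i≢j →
    dec-true (adjacent? cs _ _)
      (clique _ _ (restrict-∈⁻ X S i∈) (restrict-∈⁻ X S j∈) (i≢j ∘ embed-injective X))

module TwoPhase {n} (G : Graph n) (X : Subset n) (bipartite : IsBipartition G X) where
  open Greedy G X bipartite

  Y : List (Fin n)
  Y = filterᵇ (InY X) (allFin n)

  degree-2? : ∀ v → Dec (∣ N G v ∣ ≡ 2)
  degree-2? v = ∣ N G v ∣ ℕ.≟ 2

  Y₂ Y-rest : List (Fin n)
  Y₂     = filter degree-2? Y
  Y-rest = filter (¬? ∘ degree-2?) Y

  cherries₂ : List Cherry
  cherries₂ = greedy [] Y₂

  cherries : List Cherry
  cherries = greedy cherries₂ Y-rest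

  sound : Sound cherries
  sound = greedy-sound cherries₂ Y-rest (greedy-sound [] Y₂ [])

  H : Graph ∣ X ∣
  H = minorOf cherries

  Y-∉X : ∀ {v} → v ∈ₗ Y → lookup X v ≡ false
  Y-∉X {v} v∈Y with lookup X v | proj₂ (∈-filter⁻ (T? ∘ InY X) {xs = allFin n} v∈Y)
  ... | false | _ = refl

  Y-settled : ∀ {v} → v ∈ₗ Y → Settled cherries v
  Y-settled {v} v∈Y with degree-2? v
  ... | yes deg = Settled-mono (greedy-⊇ cherries₂ Y-rest) (greedy-settles [] (∈-filter⁺ degree-2? v∈Y deg))
  ... | no ¬deg = greedy-settles cherries₂ (∈-filter⁺ (¬? ∘ degree-2?) v∈Y ¬deg)

  Y₂-clique : ∀ {v} → v ∈ₗ Y₂ → IsCliqueIn cherries₂ (N G v)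
  Y₂-clique {v} v∈Y₂ with v∈Y , deg ← ∈-filter⁻ degree-2? {xs = Y} v∈Y₂ | greedy-settles [] v∈Y₂
  ... | inj₁ v∈X           with () ← trans (sym v∈X) (Y-∉X v∈Y)
  ... | inj₂ (inj₂ clique) = clique
  ... | inj₂ (inj₁ covered) with c , c∈ , refl ← find covered =
    subst (IsCliqueIn cherries₂) (sym (N-of-degree-2 c deg)) (pair-IsCliqueIn c∈)

  -- Such a v has degree two, so the leaves of c were adjacent after the first phase:
  -- c was created in the first phase, by a vertex whose neighbourhood is its pair of leaves.
  N≡leaves⇒N≡N-apex : ∀ {v c} → v ∈ₗ Y → c ∈ₗ cherries →
    N G v ≡ pair (leaf₁ c) (leaf₂ c) → N G v ≡ N G (apex c)
  N≡leaves⇒N≡N-apex {v} {c} v∈Y c∈ N≡leaves with greedy-origin cherries₂ Y-rest c∈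
  ... | inj₂ (_ , ¬adjacent) = ⊥-elim (¬adjacent leaves-adjacent)
    where
    v∈Y₂ : v ∈ₗ Y₂
    v∈Y₂ = ∈-filter⁺ degree-2? v∈Y (trans (cong ∣_∣ N≡leaves) (∣pair∣≡2 (leaf₁≢leaf₂ c)))
    leaf∈N : ∀ {a} → a ∈ pair (leaf₁ c) (leaf₂ c) → a ∈ N G v
    leaf∈N = subst (_ ∈_) (sym N≡leaves)
    leaves-adjacent : Adjacent cherries₂ (leaf₁ c) (leaf₂ c)
    leaves-adjacent = Y₂-clique v∈Y₂ _ _ (leaf∈N x∈pair) (leaf∈N y∈pair) (leaf₁≢leaf₂ c)
  ... | inj₁ c∈₂ with greedy-origin [] Y₂ c∈₂
  ...   | inj₂ (apex∈Y₂ , _) =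
    trans N≡leaves (sym (N-of-degree-2 c (proj₂ (∈-filter⁻ degree-2? {xs = Y} apex∈Y₂))))

  module Count (b : ℕ) (2≤b : 2 ≤ b)
               (bounded : ∀ {v} → lookup X v ≡ false → All (λ c → apex c ≢ v) cherries →
                          IsCliqueIn cherries (N G v) → ∣ N G v ∣ ≤ b) where

    SmallClique : Subset n → Set
    SmallClique S = IsCliqueIn cherries S × ∣ S ∣ ≤ b

    data Image (S : Subset n) : Set where
      itself   : SmallClique S → Image S
      leavesOf : (c : Cherry) → c ∈ₗ cherries → N G (apex c) ≡ S → Image S
      junk     : ¬ SmallClique S → ¬ Any (λ c → N G (apex c) ≡ S) cherries → Image S

    image? : ∀ S → Image S
    image? S with isCliqueIn? cherries S ×-dec (∣ S ∣ ℕ.≤? b)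
    ... | yes small = itself small
    ... | no ¬small with any? (λ c → Vec.≡-dec Bool._≟_ (N G (apex c)) S) cherries
    ...   | no ¬found = junk ¬small ¬found
    ...   | yes found with c , c∈ , N≡S ← find found = leavesOf c c∈ N≡S

    representative : ∀ {S} → Image S → Subset n
    representative {S} (itself _)       = S
    representative     (leavesOf c _ _) = pair (leaf₁ c) (leaf₂ c)
    representative {S} (junk _ _)       = S

    no-junk : ∀ {v} → v ∈ₗ Y →
      ¬ SmallClique (N G v) → ¬ Any (λ c → N G (apex c) ≡ N G v) cherries → ⊥
    no-junk v∈Y ¬small ¬found with Y-settled v∈Y
    ... | inj₁ v∈X with () ← trans (sym v∈X) (Y-∉X v∈Y)
    ... | inj₂ (inj₁ covered) with c , c∈ , refl ← find covered = ¬found (lose c∈ refl)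
    ... | inj₂ (inj₂ clique) =
      ¬small (clique , bounded (Y-∉X v∈Y) (¬Any⇒All¬ cherries (¬found ∘ Any.map (cong (N G)))) clique)

    representative-⊆X : ∀ {v} → v ∈ₗ Y → (im : Image (N G v)) → representative im ⊆ X
    representative-⊆X v∈Y (itself _)       = N⊆X (Y-∉X v∈Y)
    representative-⊆X v∈Y (leavesOf c _ _) = N⊆X (apex∉X c) ∘ leaves⊆N c
    representative-⊆X v∈Y (junk _ _)       = N⊆X (Y-∉X v∈Y)

    representative-small : ∀ {v} → v ∈ₗ Y → (im : Image (N G v)) → SmallClique (representative im)
    representative-small v∈Y (itself small)       = small
    representative-small v∈Y (leavesOf c c∈ _)    = pair-IsCliqueIn c∈ , ℕ.≤-trans (∣pair∣≤2 {x = leaf₁ c}) 2≤b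
    representative-small v∈Y (junk ¬small ¬found) = ⊥-elim (no-junk v∈Y ¬small ¬found)

    representative-injective : ∀ {v v′} → v ∈ₗ Y → v′ ∈ₗ Y →
      (im : Image (N G v)) (im′ : Image (N G v′)) →
      representative im ≡ representative im′ → N G v ≡ N G v′
    representative-injective v∈Y v′∈Y (junk ¬small ¬found) _ _ = ⊥-elim (no-junk v∈Y ¬small ¬found)
    representative-injective v∈Y v′∈Y _ (junk ¬small ¬found) _ = ⊥-elim (no-junk v′∈Y ¬small ¬found)
    representative-injective v∈Y v′∈Y (itself _) (itself _) eq = eq
    representative-injective v∈Y v′∈Y (itself _) (leavesOf c′ c′∈ N≡) eq =
      trans (N≡leaves⇒N≡N-apex v∈Y c′∈ eq) N≡
    representative-injective v∈Y v′∈Y (leavesOf c c∈ N≡) (itself _) eq =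
      sym (trans (N≡leaves⇒N≡N-apex v′∈Y c∈ (sym eq)) N≡)
    representative-injective v∈Y v′∈Y (leavesOf c c∈ N≡) (leavesOf c′ c′∈ N′≡) eq
      with refl ← edge-injective sound c∈ c′∈ (pair-injective (leaf₁≢leaf₂ c) eq)
      = trans (sym N≡) N′≡

    Φ : Subset n → Subset ∣ X ∣
    Φ S = restrict X (representative (image? S))

    count : numNbhds G X ≤ C≤ H b
    count = length-≤-injection Φ (Unique.deduplicate-! _≟ₛ_ (map (N G) Y)) injective into
      where
      _≟ₛ_ = Vec.≡-dec Bool._≟_
      nbhd : ∀ {S} → S ∈ₗ deduplicate _≟ₛ_ (map (N G) Y) → ∃ λ v → v ∈ₗ Y × S ≡ N G v
      nbhd S∈ = ∈-map⁻ (N G) (∈-deduplicate⁻ _≟ₛ_ (map (N G) Y) S∈)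
      injective : ∀ {S S′} → S ∈ₗ deduplicate _≟ₛ_ (map (N G) Y) → S′ ∈ₗ deduplicate _≟ₛ_ (map (N G) Y) →
        Φ S ≡ Φ S′ → S ≡ S′
      injective S∈ S′∈ eq with v , v∈Y , refl ← nbhd S∈ | v′ , v′∈Y , refl ← nbhd S′∈ =
        representative-injective v∈Y v′∈Y (image? _) (image? _)
          (restrict-injective X (representative-⊆X v∈Y (image? _)) (representative-⊆X v′∈Y (image? _)) eq)
      into : ∀ {S} → S ∈ₗ deduplicate _≟ₛ_ (map (N G) Y) →
        Φ S ∈ₗ filterᵇ (λ S → isCliqueᵇ H S ∧ (∣ S ∣ ≤ᵇ b)) (allSubsets ∣ X ∣)
      into S∈ with v , v∈Y , refl ← nbhd S∈
             with clique , small ← representative-small v∈Y (image? (N G v)) =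
        ∈-smallCliques H (restrict-isClique clique)
          (subst (_≤ b) (sym (∣restrict∣ X (representative-⊆X v∈Y (image? _)))) small)

lemma5 : (t : ℕ) → 3 ≤ t →
    {n : ℕ} (G : Graph n) (X : Subset n) → IsBipartition G X →
    ¬ IsOneShallowMinor (K t) G →
    Σ (Graph ∣ X ∣) λ H → IsOneShallowMinor H G ×
      ((4 ≤ t → numNbhds G X ≤ C≤ H (t ∸ 2)) ×
       (t ≡ 3 → numNbhds G X ≤ C≤ H 2))
lemma5 .(3 + j) (s≤s (s≤s (s≤s {n = j} _))) G X bipartite noK =
  H , minorOf-model sound ,
  (λ { (s≤s (s≤s (s≤s 1≤j))) → Count.count (suc j) (s≤s 1≤j) (bounded ℕ.≤-refl) }) ,
  (λ { refl → Count.count 2 ℕ.≤-refl (bounded (s≤s z≤n)) })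
  where
  open Greedy G X bipartite
  open TwoPhase G X bipartite
  bounded : ∀ {b} → suc j ≤ b → ∀ {v} → lookup X v ≡ false → All (λ c → apex c ≢ v) cherries →
    IsCliqueIn cherries (N G v) → ∣ N G v ∣ ≤ b
  bounded 1+j≤b v∉X fresh clique = ℕ.≤-trans (degree-bound sound v∉X fresh clique noK) 1+j≤b
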